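{- Let $(L,\leq)$ be a finite lattice. Then the lattice of weak factorization systems on $L$ is a semidistributive lattice.
   Context: A finite lattice $(L,\leq)$ is viewed as a category with a unique morphism $a\to b$ whenever $a\leq b$. A morphism $(a,b)$ lifts on the left a morphism $(c,d)$ if whenever $a\leq c$ and $b\leq d$ we have $b\leq c$. A weak factorization system on $L$ is a pair $(\mathcal{L},\mathcal{R})$ of sets of relations such that every relation $a\leq b$ factors as $a\leq x\leq b$ with $(a,x)\in\mathcal{L}$, $(x,b)\in\mathcal{R}$, where $\mathcal{L}$ is exactly the set of relations lifting on the left every relation of $\mathcal{R}$ and $\mathcal{R}$ is exactly the set of relations lifted on the left by every relation of $\mathcal{L}$. They are ordered by $(\mathcal{L},\mathcal{R})\preceq(\mathcal{L}',\mathcal{R}')$ iff $\mathcal{R}\subseteq\mathcal{R}'$. A lattice is semidistributive if $a\vee b=a\vee c$ implies $a\vee(b\wedge c)=a\vee b$, and $a\wedge b=a\wedge c$ implies $a\wedge(b\vee c)=a\wedge b$. -}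

module Defs where

open import Level using (0ℓ)
open import Data.Fin using (Fin)
open import Data.Bool using (Bool; true)
open import Data.Product using (_×_; ∃)
open import Function.Bundles using (_⇔_)
open import Relation.Binary.Core using (Rel)
open import Relation.Binary.PropositionalEquality using (_≡_)
open import Algebra.Core using (Op₂)
open import Relation.Binary.Lattice using (IsLattice)

-- A finite lattice is represented (up to isomorphism) by a lattice
-- structure on Fin n, with propositional equality as the underlying
-- equality.
IsFiniteLattice : (n : _) → Rel (Fin n) 0ℓ → Op₂ (Fin n) → Op₂ (Fin n) → Set
IsFiniteLattice n _≤_ _∨_ _∧_ = IsLattice _≡_ _≤_ _∨_ _∧_

SemiDistributive : ∀ {A : Set} → Rel A 0ℓ → Op₂ A → Op₂ A → Set
SemiDistributive {A} _≈_ _∨_ _∧_ =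
  (∀ (a b c : A) → (a ∨ b) ≈ (a ∨ c) → (a ∨ (b ∧ c)) ≈ (a ∨ b)) ×
  (∀ (a b c : A) → (a ∧ b) ≈ (a ∧ c) → (a ∧ (b ∨ c)) ≈ (a ∧ b))

module WFSDefs {n : _} (_≤_ : Rel (Fin n) 0ℓ) where

  RelSet : Set
  RelSet = Fin n → Fin n → Bool

  LiftsL : Fin n → Fin n → Fin n → Fin n → Set
  LiftsL a b c d = a ≤ c → b ≤ d → b ≤ c

  record IsWFS (𝓛 𝓡 : RelSet) : Set where
    field
      factor : ∀ a b → a ≤ b → ∃ λ x → (𝓛 a x ≡ true) × (𝓡 x b ≡ true)
      𝓛-char : ∀ a b → (𝓛 a b ≡ true) ⇔ ((a ≤ b) × (∀ c d → 𝓡 c d ≡ true → LiftsL a b c d))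
      𝓡-char : ∀ c d → (𝓡 c d ≡ true) ⇔ ((c ≤ d) × (∀ a b → 𝓛 a b ≡ true → LiftsL a b c d))

  record WFS : Set where
    field
      𝓛 : RelSet
      𝓡 : RelSet
      isWFS : IsWFS 𝓛 𝓡

  open WFS public

  _⪯_ : Rel WFS 0ℓ
  W ⪯ W' = ∀ c d → 𝓡 W c d ≡ true → 𝓡 W' c d ≡ true

  -- equality of weak factorization systems (same 𝓡, hence same 𝓛)
  _≈W_ : Rel WFS 0ℓ
  W ≈W W' = (W ⪯ W') × (W' ⪯ W)

{-# OPTIONS --safe #-}
-- On a finite lattice the right class of a weak factorization system is a
-- transfer system: a sub-relation of ≤ containing the identities and closed
-- under composition and under restriction (x → y and z ≤ y give x ∧ z → z).
-- Conversely every decidable transfer system is the right class of the system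
-- whose left class is obtained by lifting, a ≤ b factoring through the least
-- x ≥ a with x → b.  So meets are intersections of right classes and, lifting
-- being self-dual, joins are meets on the opposite lattice.  If a ⊓ b = a ⊓ c,
-- there is a transfer system containing the right classes of b and c, hence
-- that of b ⊔ c, whose maps in the right class of a lie in that of b; this is
-- meet-semidistributivity, and join-semidistributivity is the same argument on
-- the opposite lattice.
module Submission where

open import Defs
open import Data.Fin using (Fin)
open import Data.Product using (_×_; ∃₂)
open import Relation.Binary.Core using (Rel)
open import Algebra.Core using (Op₂)
open import Relation.Binary.Lattice using (IsLattice)
open import Level using (0ℓ)
open import Data.Nat using (ℕ)

open import Data.Bool using (true)
import Data.Bool.Properties as Bool
open import Data.Fin.Properties using (all?) renaming (_≟_ to _≟ᶠ_)
open import Data.List using (List; []; _∷_; allFin)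
open import Data.List.Relation.Unary.All as All using (All; []; _∷_)
open import Data.List.Membership.Propositional.Properties using (∈-allFin)
open import Data.Product using (∃; _,_; proj₁; proj₂; map₂; swap; zip)
open import Function using (flip; _∘_; const; id)
open import Function.Bundles using (_⇔_; mk⇔; Equivalence)
open import Relation.Nullary using (Dec; yes; no; does; contradiction)
open import Relation.Nullary.Decidable using (_×-dec_; _→-dec_)
open import Relation.Binary.Definitions using (Decidable)
open import Relation.Binary.PropositionalEquality using (_≡_; cong; subst; module ≡-Reasoning)
import Relation.Binary.PropositionalEquality as ≡
open import Relation.Binary.Structures using (IsPartialOrder)
open import Relation.Binary.Lattice using (Lattice)
open import Relation.Binary.Construct.Intersection as ∩ using (_∩_)
import Relation.Binary.Lattice.Properties.Lattice as LatticeProperties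
import Relation.Binary.Lattice.Properties.MeetSemilattice as MeetSemilatticeProperties

open Equivalence using (to; from)

does≡true⇔ : ∀ {P : Set} (p? : Dec P) → (does p? ≡ true) ⇔ P
does≡true⇔ (yes p) = mk⇔ (const p) (const ≡.refl)
does≡true⇔ (no ¬p) = mk⇔ (λ ()) (λ p → contradiction p ¬p)

module WFSClasses {n : ℕ} (_≤_ : Rel (Fin n) 0ℓ) where
  open WFSDefs _≤_ public

  Left Right : WFS → Rel (Fin n) 0ℓ
  Left w a b = 𝓛 w a b ≡ true
  Right w c d = 𝓡 w c d ≡ true

  Right? : (w : WFS) → Decidable (Right w)
  Right? w c d = 𝓡 w c d Bool.≟ true

  private variable
    a b c d : Fin n

  module Lifting (w : WFS) where
    open IsWFS (isWFS w)

    Left⇒≤ : Left w a b → a ≤ b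
    Left⇒≤ {a} {b} = proj₁ ∘ to (𝓛-char a b)

    Right⇒≤ : Right w c d → c ≤ d
    Right⇒≤ {c} {d} = proj₁ ∘ to (𝓡-char c d)

    lifts : Left w a b → Right w c d → LiftsL a b c d
    lifts {a} {b} {c} {d} l r = proj₂ (to (𝓡-char c d) r) a b l

    lifted⇒Left : a ≤ b → (∀ c d → Right w c d → LiftsL a b c d) → Left w a b
    lifted⇒Left {a} {b} a≤b h = from (𝓛-char a b) (a≤b , h)

    lifted⇒Right : c ≤ d → (∀ a b → Left w a b → LiftsL a b c d) → Right w c d
    lifted⇒Right {c} {d} c≤d h = from (𝓡-char c d) (c≤d , h)

  ⪯-refl : ∀ {v} → v ⪯ v
  ⪯-refl c d = id

  ⪯-trans : ∀ {u v w} → u ⪯ v → v ⪯ w → u ⪯ w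
  ⪯-trans u⪯v v⪯w c d = v⪯w c d ∘ u⪯v c d

  ⪯-isPartialOrder : IsPartialOrder _≈W_ _⪯_
  ⪯-isPartialOrder = record
    { isPreorder = record
      { isEquivalence = record
        { refl = λ {v} → ⪯-refl {v} , ⪯-refl {v}
        ; sym = swap
        ; trans = λ {u v w} → zip (⪯-trans {u} {v} {w}) (flip (⪯-trans {w} {v} {u})) }
      ; reflexive = proj₁
      ; trans = λ {u v w} → ⪯-trans {u} {v} {w} }
    ; antisym = _,_ }

-- (a , b) lifts on the left (c , d) for ≤ iff (d , c) lifts on the left (b , a)
-- for the opposite order; so transposing both classes dualises a weak
-- factorization system, and reverses ⪯.
module Duality {n : ℕ} (_≤_ : Rel (Fin n) 0ℓ) where
  open WFSClasses _≤_
  module Op = WFSClasses (flip _≤_)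

  dual : WFS → Op.WFS
  dual w = record
    { 𝓛 = flip (𝓡 w)
    ; 𝓡 = flip (𝓛 w)
    ; isWFS = record
      { factor = λ a b b≤a → let x , l , r = factor b a b≤a in x , r , l
      ; 𝓛-char = λ a b → mk⇔ (map₂ (λ h c d → flip ∘ h d c) ∘ to (𝓡-char b a))
                              (from (𝓡-char b a) ∘ map₂ (λ h c d → flip ∘ h d c))
      ; 𝓡-char = λ c d → mk⇔ (map₂ (λ h a b → flip ∘ h b a) ∘ to (𝓛-char d c))
                              (from (𝓛-char d c) ∘ map₂ (λ h a b → flip ∘ h b a)) } }
    where open IsWFS (isWFS w)

  dual-antitone : ∀ {v w} → v ⪯ w → dual w Op.⪯ dual v
  dual-antitone {v} {w} v⪯w b a l = V.lifted⇒Left (W.Left⇒≤ l) (λ c d r → W.lifts l (v⪯w c d r))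
    where
    module V = Lifting v
    module W = Lifting w

  dual-antitone⁻¹ : ∀ {v w} → dual w Op.⪯ dual v → v ⪯ w
  dual-antitone⁻¹ {v} {w} Lw⊆Lv c d r =
    W.lifted⇒Right (V.Right⇒≤ r) (λ a b l → V.lifts (Lw⊆Lv b a l) r)
    where
    module V = Lifting v
    module W = Lifting w

module Meets {n : ℕ} {_≤_ : Rel (Fin n) 0ℓ} {_∨_ _∧_ : Op₂ (Fin n)}
             (isLattice : IsLattice _≡_ _≤_ _∨_ _∧_) where
  lattice : Lattice 0ℓ 0ℓ 0ℓ
  lattice = record { isLattice = isLattice }

  open WFSClasses _≤_
  open IsLattice isLattice using (antisym; x∧y≤x; x∧y≤y; ∧-greatest)
    renaming (refl to ≤-refl; trans to ≤-trans)
  open MeetSemilatticeProperties (Lattice.meetSemilattice lattice)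
    using (∧-assoc; y≤x⇒x∧y≈y; ≈-dec⇒≤-dec)

  private variable
    x y z : Fin n

  _≤?_ : Decidable _≤_
  _≤?_ = ≈-dec⇒≤-dec _≟ᶠ_

  x≤y⇒x∧y≡x : x ≤ y → x ∧ y ≡ x
  x≤y⇒x∧y≡x x≤y = antisym (x∧y≤x _ _) (∧-greatest ≤-refl x≤y)

  ∧-closed-least : {Q : Fin n → Set} → (∀ y → Dec (Q y)) → (∀ {y z} → Q y → Q z → Q (y ∧ z)) →
                   Q x → ∃ λ m → Q m × ∀ {y} → Q y → m ≤ y
  ∧-closed-least {x} {Q} Q? ∧-closed Qx with lowerBoundOf (allFin n)
    where
    lowerBoundOf : (ys : List (Fin n)) → ∃ λ m → Q m × All (λ y → Q y → m ≤ y) ys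
    lowerBoundOf [] = x , Qx , []
    lowerBoundOf (y ∷ ys) with lowerBoundOf ys | Q? y
    ... | m , Qm , below | yes Qy =
      m ∧ y , ∧-closed Qm Qy ,
      const (x∧y≤y m y) ∷ All.map (λ m≤ Qz → ≤-trans (x∧y≤x m y) (m≤ Qz)) below
    ... | m , Qm , below | no ¬Qy = m , Qm , (λ Qy → contradiction Qy ¬Qy) ∷ below
  ... | m , Qm , below = m , Qm , λ {y} → All.lookup below (∈-allFin y)

  record IsTransferSystem (P : Rel (Fin n) 0ℓ) : Set where
    field
      ⊆-≤ : P x y → x ≤ y
      refl : P x x
      trans : P x y → P y z → P x z
      restrict : P x y → z ≤ y → P (x ∧ z) z

    restrict-between : P x y → x ≤ z → z ≤ y → P x z
    restrict-between {x} {z = z} p x≤z z≤y = subst (λ u → P u z) (x≤y⇒x∧y≡x x≤z) (restrict p z≤y)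

  Right-isTransferSystem : (w : WFS) → IsTransferSystem (Right w)
  Right-isTransferSystem w = record
    { ⊆-≤ = Right⇒≤
    ; refl = lifted⇒Right ≤-refl (λ _ _ _ _ b≤x → b≤x)
    ; trans = λ Rxy Ryz → lifted⇒Right (≤-trans (Right⇒≤ Rxy) (Right⇒≤ Ryz)) (λ a b l a≤x b≤z →
        lifts l Rxy a≤x (lifts l Ryz (≤-trans a≤x (Right⇒≤ Rxy)) b≤z))
    ; restrict = λ Rxy z≤y → lifted⇒Right (x∧y≤y _ _) (λ a b l a≤x∧z b≤z →
        ∧-greatest (lifts l Rxy (≤-trans a≤x∧z (x∧y≤x _ _)) (≤-trans b≤z z≤y)) b≤z)
    }
    where open Lifting w

  module _ {P : Rel (Fin n) 0ℓ} (P? : Decidable P) (isTS : IsTransferSystem P) where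
    open IsTransferSystem isTS

    LeftLifting : Rel (Fin n) 0ℓ
    LeftLifting a b = a ≤ b × (∀ c d → P c d → LiftsL a b c d)

    LeftLifting? : Decidable LeftLifting
    LeftLifting? a b = (a ≤? b) ×-dec all? λ c → all? λ d →
      P? c d →-dec ((a ≤? c) →-dec ((b ≤? d) →-dec (b ≤? c)))

    factorise : {a b : Fin n} → a ≤ b → ∃ λ x → LeftLifting a x × P x b
    factorise {a} {b} a≤b with ∧-closed-least (λ y → (a ≤? y) ×-dec P? y b) ∧-closed (a≤b , refl)
      where
      ∧-closed : ∀ {y z} → a ≤ y × P y b → a ≤ z × P z b → a ≤ (y ∧ z) × P (y ∧ z) b
      ∧-closed (a≤y , Pyb) (a≤z , Pzb) = ∧-greatest a≤y a≤z , trans (restrict Pyb (⊆-≤ Pzb)) Pzb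
    ... | x , (a≤x , Pxb) , least = x , (a≤x , lifts) , Pxb
      where
      -- the restriction c ∧ x → x of c → d, followed by x → b, is in P, so x ≤ c ∧ x
      lifts : ∀ c d → P c d → LiftsL a x c d
      lifts c d Pcd a≤c x≤d =
        ≤-trans (least (∧-greatest a≤c a≤x , trans (restrict Pcd x≤d) Pxb)) (x∧y≤x c x)

    -- factor c ≤ d as c ≤ x ≤ d; lifting c → x against c → d itself gives x ≤ c
    lifted⇒P : {c d : Fin n} → c ≤ d → (∀ a b → LeftLifting a b → LiftsL a b c d) → P c d
    lifted⇒P {c} {d} c≤d h with factorise c≤d
    ... | x , c↝x , Pxd = subst (λ u → P u d) (antisym (h c x c↝x ≤-refl (⊆-≤ Pxd)) (proj₁ c↝x)) Pxd

    fromTransferSystem : WFS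
    fromTransferSystem = record
      { 𝓛 = λ a b → does (LeftLifting? a b)
      ; 𝓡 = λ c d → does (P? c d)
      ; isWFS = record
        { factor = λ a b a≤b →
            let x , l , r = factorise a≤b in x , from (LeftLifting⇔ a x) l , from (P⇔ x b) r
        ; 𝓛-char = λ a b → mk⇔ (map₂ (λ h c d → h c d ∘ to (P⇔ c d)) ∘ to (LeftLifting⇔ a b))
                                (from (LeftLifting⇔ a b) ∘ map₂ (λ h c d → h c d ∘ from (P⇔ c d)))
        ; 𝓡-char = λ c d → mk⇔
            (λ r → ⊆-≤ (to (P⇔ c d) r) , λ a b l → proj₂ (to (LeftLifting⇔ a b) l) c d (to (P⇔ c d) r))
            (λ (c≤d , h) → from (P⇔ c d) (lifted⇒P c≤d (λ a b → h a b ∘ from (LeftLifting⇔ a b)))) } }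
      where
      P⇔ : ∀ c d → (does (P? c d) ≡ true) ⇔ P c d
      P⇔ c d = does≡true⇔ (P? c d)
      LeftLifting⇔ : ∀ a b → (does (LeftLifting? a b) ≡ true) ⇔ LeftLifting a b
      LeftLifting⇔ a b = does≡true⇔ (LeftLifting? a b)

    Right-fromTransferSystem : Right fromTransferSystem x y ⇔ P x y
    Right-fromTransferSystem {x} {y} = does≡true⇔ (P? x y)

  ∩-isTransferSystem : ∀ {P Q} → IsTransferSystem P → IsTransferSystem Q → IsTransferSystem (P ∩ Q)
  ∩-isTransferSystem isP isQ = record
    { ⊆-≤ = P.⊆-≤ ∘ proj₁
    ; refl = P.refl , Q.refl
    ; trans = zip P.trans Q.trans
    ; restrict = λ (p , q) z≤y → P.restrict p z≤y , Q.restrict q z≤y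
    }
    where
    module P = IsTransferSystem isP
    module Q = IsTransferSystem isQ

  infixr 7 _⊓_

  _⊓_ : WFS → WFS → WFS
  v ⊓ w = fromTransferSystem (∩.decidable (Right? v) (Right? w))
                             (∩-isTransferSystem (Right-isTransferSystem v) (Right-isTransferSystem w))

  Right-⊓ : ∀ v w → Right (v ⊓ w) x y ⇔ (Right v x y × Right w x y)
  Right-⊓ v w = Right-fromTransferSystem (∩.decidable (Right? v) (Right? w))
                                        (∩-isTransferSystem (Right-isTransferSystem v) (Right-isTransferSystem w))

  ⊓-lowerˡ : ∀ v w → (v ⊓ w) ⪯ v
  ⊓-lowerˡ v w x y = proj₁ ∘ to (Right-⊓ v w)

  ⊓-lowerʳ : ∀ v w → (v ⊓ w) ⪯ w
  ⊓-lowerʳ v w x y = proj₂ ∘ to (Right-⊓ v w)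

  ⊓-greatest : ∀ {u v w} → u ⪯ v → u ⪯ w → u ⪯ (v ⊓ w)
  ⊓-greatest {v = v} {w} u⪯v u⪯w x y r = from (Right-⊓ v w) (u⪯v x y r , u⪯w x y r)

  x≤y⇒x∧[y∧z]≡x∧z : x ≤ y → x ∧ (y ∧ z) ≡ x ∧ z
  x≤y⇒x∧[y∧z]≡x∧z {x} {y} {z} x≤y = begin
    x ∧ (y ∧ z) ≡⟨ ≡.sym (∧-assoc x y z) ⟩
    (x ∧ y) ∧ z ≡⟨ cong (_∧ z) (x≤y⇒x∧y≡x x≤y) ⟩
    x ∧ z       ∎
    where open ≡-Reasoning

  z≤y⇒[x∧y]∧z≡x∧z : z ≤ y → (x ∧ y) ∧ z ≡ x ∧ z
  z≤y⇒[x∧y]∧z≡x∧z {z} {y} {x} z≤y = begin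
    (x ∧ y) ∧ z ≡⟨ ∧-assoc x y z ⟩
    x ∧ (y ∧ z) ≡⟨ cong (x ∧_) (y≤x⇒x∧y≈y z≤y) ⟩
    x ∧ z       ∎
    where open ≡-Reasoning

  -- A transfer system containing 𝓡 b, and also 𝓡 c when a ⊓ b ≈W a ⊓ c; its
  -- instance z = y, c = x says that its maps which lie in 𝓡 a lie in 𝓡 b.
  module _ (a b : WFS) where
    Extends : Rel (Fin n) 0ℓ
    Extends x y = x ≤ y × ∀ z c → z ≤ y → Right (a ⊓ b) c (x ∧ z) → Right a c z → Right b c z

    Extends? : Decidable Extends
    Extends? x y = (x ≤? y) ×-dec all? λ z → all? λ c →
      (z ≤? y) →-dec (Right? (a ⊓ b) c (x ∧ z) →-dec (Right? a c z →-dec Right? b c z))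

    private
      module Ra = IsTransferSystem (Right-isTransferSystem a)

    Extends-trans : Extends x y → Extends y z → Extends x z
    Extends-trans {x} {y} {t} (x≤y , x↝y) (y≤t , y↝t) = ≤-trans x≤y y≤t , λ z c z≤t Rab Ra →
      let c≤x∧z = Lifting.Right⇒≤ (a ⊓ b) Rab
          c≤y∧z = ∧-greatest (≤-trans c≤x∧z (≤-trans (x∧y≤x x z) x≤y)) (≤-trans c≤x∧z (x∧y≤y x z))
          Ra′ = Ra.restrict-between Ra c≤y∧z (x∧y≤y y z)
          Rab′ = subst (Right (a ⊓ b) c) (≡.sym (x≤y⇒x∧[y∧z]≡x∧z x≤y)) Rab
      in y↝t z c z≤t (from (Right-⊓ a b) (Ra′ , x↝y (y ∧ z) c (x∧y≤x y z) Rab′ Ra′)) Ra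

    Extends-isTransferSystem : IsTransferSystem Extends
    Extends-isTransferSystem = record
      { ⊆-≤ = proj₁
      ; refl = ≤-refl , λ z c z≤y Rab _ →
          proj₂ (to (Right-⊓ a b) (subst (Right (a ⊓ b) c) (y≤x⇒x∧y≈y z≤y) Rab))
      ; trans = Extends-trans
      ; restrict = λ (x≤y , x↝y) z≤y → x∧y≤y _ _ , λ t c t≤z Rab →
          x↝y t c (≤-trans t≤z z≤y) (subst (Right (a ⊓ b) c) (z≤y⇒[x∧y]∧z≡x∧z t≤z) Rab)
      }

  ⊓-semidistrib-belowJoin : ∀ {a b c u} → (a ⊓ b) ≈W (a ⊓ c) → (∀ {z} → b ⪯ z → c ⪯ z → u ⪯ z) →
                            (a ⊓ u) ⪯ b
  ⊓-semidistrib-belowJoin {a} {b} {c} {u} (ab⪯ac , ac⪯ab) u⪯ub x y Rau =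
    proj₂ x↝y y x ≤-refl Rab-x Ra
    where
    module Rb = IsTransferSystem (Right-isTransferSystem b)
    module Rc = IsTransferSystem (Right-isTransferSystem c)

    E : WFS
    E = fromTransferSystem (Extends? a b) (Extends-isTransferSystem a b)

    Right-E : ∀ {x y} → Right E x y ⇔ Extends a b x y
    Right-E = Right-fromTransferSystem (Extends? a b) (Extends-isTransferSystem a b)

    b⪯E : b ⪯ E
    b⪯E x y Rb = from Right-E (Rb.⊆-≤ Rb , λ z c z≤y Rab _ →
      Rb.trans (proj₂ (to (Right-⊓ a b) Rab)) (Rb.restrict Rb z≤y))

    c⪯E : c ⪯ E
    c⪯E x y Rc = from Right-E (Rc.⊆-≤ Rc , λ z c′ z≤y Rab Ra →
      let Rc′ = Rc.trans (proj₂ (to (Right-⊓ a c) (ab⪯ac c′ _ Rab))) (Rc.restrict Rc z≤y)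
      in proj₂ (to (Right-⊓ a b) (ac⪯ab c′ z (from (Right-⊓ a c) (Ra , Rc′)))))

    Ra : Right a x y
    Ra = proj₁ (to (Right-⊓ a u) Rau)

    x↝y : Extends a b x y
    x↝y = to Right-E (u⪯ub {E} b⪯E c⪯E x y (proj₂ (to (Right-⊓ a u) Rau)))

    Rab-x : Right (a ⊓ b) x (x ∧ y)
    Rab-x = subst (Right (a ⊓ b) x) (≡.sym (x≤y⇒x∧y≡x (Lifting.Right⇒≤ a Ra)))
                  (IsTransferSystem.refl (Right-isTransferSystem (a ⊓ b)))

module WFSLattice {n : ℕ} {_≤_ : Rel (Fin n) 0ℓ} {_∨_ _∧_ : Op₂ (Fin n)}
                  (isLattice : IsLattice _≡_ _≤_ _∨_ _∧_) where
  open WFSClasses _≤_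
  open Meets isLattice hiding (_⊓_)
  open Meets isLattice public using (_⊓_)
  open Duality _≤_ using (dual; dual-antitone; dual-antitone⁻¹)
  open Duality (flip _≤_) using () renaming (dual to undual; dual-antitone to undual-antitone)
  open WFSDefs (flip _≤_) using () renaming (_⪯_ to _⪯ᵒᵖ_)
  module Op = Meets (LatticeProperties.∧-∨-isLattice lattice)

  infixr 6 _⊔_

  _⊔_ : WFS → WFS → WFS
  v ⊔ w = undual (dual v Op.⊓ dual w)

  ⊔-upperˡ : ∀ v w → v ⪯ (v ⊔ w)
  ⊔-upperˡ v w = dual-antitone⁻¹ {v} {v ⊔ w} (Op.⊓-lowerˡ (dual v) (dual w))

  ⊔-upperʳ : ∀ v w → w ⪯ (v ⊔ w)
  ⊔-upperʳ v w = dual-antitone⁻¹ {w} {v ⊔ w} (Op.⊓-lowerʳ (dual v) (dual w))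

  ⊔-least : ∀ {u v w} → v ⪯ u → w ⪯ u → (v ⊔ w) ⪯ u
  ⊔-least {u} {v} {w} v⪯u w⪯u =
    dual-antitone⁻¹ {v ⊔ w} {u}
      (Op.⊓-greatest {dual u} {dual v} {dual w} (dual-antitone {v} {u} v⪯u) (dual-antitone {w} {u} w⪯u))

  ⪯-isLattice : IsLattice _≈W_ _⪯_ _⊔_ _⊓_
  ⪯-isLattice = record
    { isPartialOrder = ⪯-isPartialOrder
    ; supremum = λ v w → ⊔-upperˡ v w , ⊔-upperʳ v w , λ u → ⊔-least {u} {v} {w}
    ; infimum = λ v w → ⊓-lowerˡ v w , ⊓-lowerʳ v w , λ u → ⊓-greatest {u} {v} {w}
    }

  ⊓-semidistrib : ∀ a b c → (a ⊓ b) ≈W (a ⊓ c) → (a ⊓ (b ⊔ c)) ≈W (a ⊓ b)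
  ⊓-semidistrib a b c ab≈ac =
      ⊓-greatest {a ⊓ (b ⊔ c)} {a} {b} (⊓-lowerˡ a (b ⊔ c))
        (⊓-semidistrib-belowJoin {a} {b} {c} {b ⊔ c} ab≈ac (λ {z} → ⊔-least {z} {b} {c}))
    , ⊓-greatest {a ⊓ b} {a} {b ⊔ c} (⊓-lowerˡ a b)
        (⪯-trans {a ⊓ b} {b} {b ⊔ c} (⊓-lowerʳ a b) (⊔-upperˡ b c))

  ⊔-semidistrib : ∀ a b c → (a ⊔ b) ≈W (a ⊔ c) → (a ⊔ (b ⊓ c)) ≈W (a ⊔ b)
  ⊔-semidistrib a b c (ab⪯ac , ac⪯ab) =
      ⊔-least {a ⊔ b} {a} {b ⊓ c} (⊔-upperˡ a b)
        (⪯-trans {b ⊓ c} {b} {a ⊔ b} (⊓-lowerˡ b c) (⊔-upperʳ a b))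
    , dual-antitone⁻¹ {a ⊔ b} {a ⊔ (b ⊓ c)}
        (Op.⊓-greatest {dual (a ⊔ (b ⊓ c))} {dual a} {dual b} (Op.⊓-lowerˡ (dual a) (dual (b ⊓ c)))
          (Op.⊓-semidistrib-belowJoin {dual a} {dual b} {dual c} {dual (b ⊓ c)}
            (dual-antitone {a ⊔ c} {a ⊔ b} ac⪯ab , dual-antitone {a ⊔ b} {a ⊔ c} ab⪯ac)
            (λ {z} → b⊓c-below {z})))
    where
    b⊓c-below : ∀ {z} → dual b ⪯ᵒᵖ z → dual c ⪯ᵒᵖ z → dual (b ⊓ c) ⪯ᵒᵖ z
    b⊓c-below {z} b°⪯z c°⪯z = dual-antitone {undual z} {b ⊓ c}
      (⊓-greatest {undual z} {b} {c} (undual-antitone {dual b} {z} b°⪯z) (undual-antitone {dual c} {z} c°⪯z))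

mainTheorem2 : (n : ℕ) (_≤_ : Rel (Fin n) 0ℓ) (_∨_ _∧_ : Op₂ (Fin n)) →
    IsFiniteLattice n _≤_ _∨_ _∧_ →
    ∃₂ λ (_⊔_ _⊓_ : Op₂ (WFSDefs.WFS _≤_)) →
      IsLattice (WFSDefs._≈W_ _≤_) (WFSDefs._⪯_ _≤_) _⊔_ _⊓_ ×
      SemiDistributive (WFSDefs._≈W_ _≤_) _⊔_ _⊓_
mainTheorem2 n _≤_ _∨_ _∧_ isLattice = _⊔_ , _⊓_ , ⪯-isLattice , ⊔-semidistrib , ⊓-semidistrib
  where open WFSLattice isLattice
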